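{- Let $m \ge 1$ and let $A^{(m)}$ be the $m$th-order curling sequence. If $A^{(m)}$ contains, as a substring (i.e. as consecutive terms), a string $U^{t+1}$ (that is, $t+1$ consecutive copies of $U$), where $U$ is a nonempty finite string of integers $\ge m$ and $t \ge m$ is an integer, then every entry of $U$ is $\ge t$.
   Context: For a nonempty finite string $U$ of positive integers, its curling number $\mathcal{C}(U)$ is the largest integer $k \ge 1$ such that $U = XY^k$ (concatenation of $X$ with $k$ copies of $Y$) for some strings $X, Y$ with $Y$ nonempty ($X$ may be empty). For $m \ge 1$ put $\mathcal{C}^{(m)}(U) = \max\{m, \mathcal{C}(U)\}$. The $m$th-order sequence $A^{(m)} = a^{(m)}(1), a^{(m)}(2), \ldots$ is defined by $a^{(m)}(1) = m$ and $a^{(m)}(i+1) = \mathcal{C}^{(m)}(a^{(m)}(1), \ldots, a^{(m)}(i))$ for $i \ge 1$. A string $V$ is contained in a sequence $W$ if the entries of $V$ occur consecutively in $W$. -}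

module Defs where

open import Data.Nat using (ℕ; zero; suc; _+_; _≤_; _⊔_)
open import Data.List using (List; []; _∷_; _++_; concat; replicate; map; upTo; length)
open import Data.Product using (Σ; ∃; _×_)
open import Relation.Binary.PropositionalEquality using (_≡_; _≢_)

_^^_ : List ℕ → ℕ → List ℕ
Y ^^ k = concat (replicate k Y)

HasCurl : List ℕ → ℕ → Set
HasCurl U k = ∃ λ (X : List ℕ) → ∃ λ (Y : List ℕ) → (Y ≢ []) × (U ≡ X ++ (Y ^^ k))

IsCurlingNumber : List ℕ → ℕ → Set
IsCurlingNumber U c =
  (1 ≤ c) × HasCurl U c × (∀ k → 1 ≤ k → HasCurl U k → k ≤ c)

prefix : (ℕ → ℕ) → ℕ → List ℕ
prefix a n = map a (upTo n)

-- a is the m-th order curling sequence (0-indexed: a 0 = a^(m)(1)):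
-- a(1) = m, a(i+1) = max{m, C(a(1),...,a(i))}
IsCurlingSeq : ℕ → (ℕ → ℕ) → Set
IsCurlingSeq m a =
  (a 0 ≡ m) ×
  (∀ i c → IsCurlingNumber (prefix a (suc i)) c → a (suc i) ≡ m ⊔ c)

ContainedIn : List ℕ → (ℕ → ℕ) → Set
ContainedIn V a = ∃ λ s → map (λ i → a (s + i)) (upTo (length V)) ≡ V

-- Write an entry x of U as U = P ++ x ∷ Q. Inside the occurrence of U^(t+1) = P (x Q P)^t x Q,
-- the last copy of x is preceded by t copies of the block x Q P, so the curling number of the
-- prefix of the sequence ending just before it is at least t, and that term equals max(m, C) ≥ t.
-- The curling number of a prefix is only known to exist classically (¬¬), which suffices here
-- because the goal t ≤ x is decidable.
module Submission where

open import Defs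
open import Data.Nat using (ℕ; zero; suc; _+_; _⊔_; _≤_; z≤n; s≤s; _≤?_)
open import Data.Nat.Properties
  using (≤-trans; ≤∧≢⇒<; m<1+n⇒m≤n; m≤n+m; m≤n⊔m; module ≤-Reasoning)
open import Data.List using (List; []; _∷_; _++_; length; applyUpTo)
open import Data.List.Properties using (∷-injective; ++-assoc; ++-identityʳ; length-++; map-upTo)
open import Data.List.Membership.Propositional using (_∈_)
open import Data.List.Membership.Propositional.Properties using (∈-∃++)
open import Data.List.Relation.Unary.All as All using (All)
open import Data.Product using (∃; _×_; _,_; proj₁)
open import Relation.Nullary using (¬_; contradiction)
open import Relation.Nullary.Decidable using (decidable-stable)
open import Relation.Binary.PropositionalEquality
  using (_≡_; _≢_; refl; sym; trans; cong; cong₂; subst; module ≡-Reasoning)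

¬¬-greatest : (P : ℕ → Set) (n : ℕ) → P 1 → (∀ k → 1 ≤ k → P k → k ≤ n) →
              ¬ ¬ (∃ λ c → 1 ≤ c × P c × (∀ k → 1 ≤ k → P k → k ≤ c))
¬¬-greatest P zero    p₁ bounded _         = contradiction (bounded 1 (s≤s z≤n) p₁) λ ()
¬¬-greatest P (suc n) p₁ bounded ¬greatest = ¬¬-greatest P n p₁ bounded′ ¬greatest
  where
  ¬P[1+n] : ¬ P (suc n)
  ¬P[1+n] p = ¬greatest (suc n , s≤s z≤n , p , bounded)

  bounded′ : ∀ k → 1 ≤ k → P k → k ≤ n
  bounded′ k 1≤k pk = m<1+n⇒m≤n (≤∧≢⇒< (bounded k 1≤k pk) λ { refl → ¬P[1+n] pk })

k≤length-^^ : ∀ (y : ℕ) (Y : List ℕ) k → k ≤ length ((y ∷ Y) ^^ k)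
k≤length-^^ y Y zero    = z≤n
k≤length-^^ y Y (suc k) = s≤s (begin
  k                               ≤⟨ k≤length-^^ y Y k ⟩
  length ((y ∷ Y) ^^ k)            ≤⟨ m≤n+m _ (length Y) ⟩
  length Y + length ((y ∷ Y) ^^ k) ≡⟨ sym (length-++ Y) ⟩
  length (Y ++ (y ∷ Y) ^^ k)       ∎)
  where open ≤-Reasoning

HasCurl⇒≤length : ∀ {U k} → HasCurl U k → k ≤ length U
HasCurl⇒≤length (X , [] , Y≢[] , _) = contradiction refl Y≢[]
HasCurl⇒≤length {k = k} (X , y ∷ Y , _ , refl) = begin
  k                                       ≤⟨ k≤length-^^ y Y k ⟩
  length ((y ∷ Y) ^^ k)                    ≤⟨ m≤n+m _ (length X) ⟩
  length X + length ((y ∷ Y) ^^ k)         ≡⟨ sym (length-++ X) ⟩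
  length (X ++ (y ∷ Y) ^^ k)               ∎
  where open ≤-Reasoning

HasCurl-1 : ∀ {U} → U ≢ [] → HasCurl U 1
HasCurl-1 {U} U≢[] = [] , U , U≢[] , sym (++-identityʳ U)

curlingNumber-¬¬exists : ∀ U → U ≢ [] → ¬ ¬ ∃ (IsCurlingNumber U)
curlingNumber-¬¬exists U U≢[] =
  ¬¬-greatest (HasCurl U) (length U) (HasCurl-1 U≢[]) (λ _ _ → HasCurl⇒≤length)

curlingSeq-curl≤next : ∀ {m a} → IsCurlingSeq m a →
                       ∀ n k → 1 ≤ k → HasCurl (prefix a n) k → k ≤ a n
curlingSeq-curl≤next _ zero k 1≤k curl =
  contradiction (≤-trans 1≤k (HasCurl⇒≤length curl)) λ ()
curlingSeq-curl≤next {m} {a} (_ , next) (suc i) k 1≤k curl =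
  decidable-stable (k ≤? a (suc i)) λ k≰next →
    curlingNumber-¬¬exists (prefix a (suc i)) (λ ()) λ { (c , isC@(_ , _ , greatest)) →
      k≰next (begin
        k      ≤⟨ greatest k 1≤k curl ⟩
        c      ≤⟨ m≤n⊔m m c ⟩
        m ⊔ c  ≡⟨ sym (next i c isC) ⟩
        a (suc i) ∎) }
  where open ≤-Reasoning

applyUpTo-+ : ∀ {A : Set} (f : ℕ → A) k l →
              applyUpTo f (k + l) ≡ applyUpTo f k ++ applyUpTo (λ i → f (k + i)) l
applyUpTo-+ f zero    l = refl
applyUpTo-+ f (suc k) l = cong (f 0 ∷_) (applyUpTo-+ (λ i → f (suc i)) k l)

applyUpTo≡++∷ : ∀ {A : Set} (f : ℕ → A) n V x Q → applyUpTo f n ≡ V ++ x ∷ Q →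
                applyUpTo f (length V) ≡ V × f (length V) ≡ x
applyUpTo≡++∷ f zero    []      x Q ()
applyUpTo≡++∷ f zero    (v ∷ V) x Q ()
applyUpTo≡++∷ f (suc n) []      x Q eq = refl , proj₁ (∷-injective eq)
applyUpTo≡++∷ f (suc n) (v ∷ V) x Q eq
  with refl , tail≡ ← ∷-injective eq
  with prefix≡V , f[1+|V|]≡x ← applyUpTo≡++∷ (λ i → f (suc i)) n V x Q tail≡ =
  cong (v ∷_) prefix≡V , f[1+|V|]≡x

ContainedIn-++∷ : ∀ {V x Q a} → ContainedIn (V ++ x ∷ Q) a →
                  ∃ λ n → ∃ λ X → prefix a n ≡ X ++ V × a n ≡ x
ContainedIn-++∷ {V} {x} {Q} {a} (s , occurs)
  with applyUpTo≡++∷ (λ i → a (s + i)) _ V x Q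
         (trans (sym (map-upTo (λ i → a (s + i)) _)) occurs)
... | window≡V , a[s+|V|]≡x = s + length V , prefix a s , prefix≡ , a[s+|V|]≡x
  where
  open ≡-Reasoning
  prefix≡ : prefix a (s + length V) ≡ prefix a s ++ V
  prefix≡ = begin
    prefix a (s + length V)                                 ≡⟨ map-upTo a _ ⟩
    applyUpTo a (s + length V)                              ≡⟨ applyUpTo-+ a s (length V) ⟩
    applyUpTo a s ++ applyUpTo (λ i → a (s + i)) (length V) ≡⟨ cong₂ _++_ (sym (map-upTo a s)) window≡V ⟩
    prefix a s ++ V                                         ∎

^^-rotate : ∀ (P R : List ℕ) k → (P ++ R) ^^ suc k ≡ (P ++ (R ++ P) ^^ k) ++ R
^^-rotate P R k = trans (rotate k) (sym (++-assoc P ((R ++ P) ^^ k) R))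
  where
  open ≡-Reasoning
  rotate : ∀ k → (P ++ R) ^^ suc k ≡ P ++ ((R ++ P) ^^ k ++ R)
  rotate zero    = ++-identityʳ (P ++ R)
  rotate (suc k) = begin
    (P ++ R) ++ (P ++ R) ^^ suc k                   ≡⟨ cong ((P ++ R) ++_) (rotate k) ⟩
    (P ++ R) ++ (P ++ ((R ++ P) ^^ k ++ R))          ≡⟨ ++-assoc P R _ ⟩
    P ++ (R ++ (P ++ ((R ++ P) ^^ k ++ R)))          ≡⟨ cong (P ++_) (sym (++-assoc R P _)) ⟩
    P ++ ((R ++ P) ++ ((R ++ P) ^^ k ++ R))          ≡⟨ cong (P ++_) (sym (++-assoc (R ++ P) _ R)) ⟩
    P ++ ((R ++ P) ^^ suc k ++ R)                   ∎

lemma1 : (m : ℕ) → 1 ≤ m → (a : ℕ → ℕ) → IsCurlingSeq m a →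
         (U : List ℕ) → U ≢ [] → All (m ≤_) U →
         (t : ℕ) → m ≤ t → ContainedIn (U ^^ suc t) a →
         All (t ≤_) U
lemma1 m 1≤m a seq U _ _ t m≤t occurs = All.tabulate t≤entry
  where
  t≤entry : ∀ {x} → x ∈ U → t ≤ x
  t≤entry {x} x∈U with P , Q , refl ← ∈-∃++ x∈U
    with n , X , prefix≡ , aₙ≡x ← ContainedIn-++∷ (subst (λ W → ContainedIn W a)
                                     (^^-rotate P (x ∷ Q) t) occurs) =
    subst (t ≤_) aₙ≡x (curlingSeq-curl≤next seq n t (≤-trans 1≤m m≤t)
      (X ++ P , x ∷ Q ++ P , (λ ()) , trans prefix≡ (sym (++-assoc X P _))))
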